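{- Let $D$ be a unique factorization domain and let $a,b$ be elements algebraic over $D$ such that $(a+b)^2$ and $ab$ are coprime elements of $D$. Let $m, n$ be positive coprime integers with $m$ odd and $n$ even. Then $P_m(a,b)$ and $P_n(a,b)/(a+b)$ (which lie in $D$) are coprime in $D$.
   Context: For $n \ge 1$, $P_n(X,Y) = \frac{X^n - Y^n}{X-Y} = \sum_{k=0}^{n-1}X^{n-1-k}Y^k \in \mathbb{Z}[X,Y]$. Coprime means having no common prime divisor in $D$. -}

module Defs where

open import Level using (Level; _⊔_)
open import Algebra.Bundles using (CommutativeRing; Semiring)
open import Algebra.Morphism.Structures using (module RingMorphisms)
import Algebra.Definitions.RawSemiring as RawSemiringDefs
open import Data.Nat as ℕ using (ℕ; suc; _∸_; _/_)
open import Data.Fin using (Fin; toℕ)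
open import Data.Fin.Permutation using (Permutation; _⟨$⟩ʳ_)
open import Data.Product using (Σ; ∃; _×_; _,_)
open import Data.Sum using (_⊎_)
open import Data.Empty using (⊥)
open import Relation.Nullary using (¬_)

private
  variable
    c ℓ c₂ ℓ₂ : Level

module _ (R : CommutativeRing c ℓ) where
  open CommutativeRing R renaming (Carrier to A)
  open RawSemiringDefs (Semiring.rawSemiring semiring) hiding (_×_)

  IsUnit : A → Set (c ⊔ ℓ)
  IsUnit u = u ∣ 1#

  Associated : A → A → Set (c ⊔ ℓ)
  Associated x y = x ∣ y × y ∣ x

  record IsIntegralDomain : Set (c ⊔ ℓ) where
    field
      1≉0 : ¬ (1# ≈ 0#)
      noZeroDivisors : ∀ x y → x * y ≈ 0# → x ≈ 0# ⊎ y ≈ 0#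

  record IsUFD : Set (c ⊔ ℓ) where
    field
      isIntegralDomain : IsIntegralDomain
      factorization : ∀ x → ¬ (x ≈ 0#) → ¬ IsUnit x →
        Σ ℕ λ k → Σ (Fin k → A) λ ps →
          (∀ i → Irreducible (ps i)) × (x ≈ product ps)
      uniqueness : ∀ k l (ps : Fin k → A) (qs : Fin l → A) →
        (∀ i → Irreducible (ps i)) → (∀ j → Irreducible (qs j)) →
        product ps ≈ product qs →
        Σ (Permutation k l) λ σ → ∀ i → Associated (ps i) (qs (σ ⟨$⟩ʳ i))

  CoprimeElts : A → A → Set (c ⊔ ℓ)
  CoprimeElts x y = ∀ p → Prime p → p ∣ x → p ∣ y → ⊥

  P : ℕ → A → A → A
  P n x y = sum {n} λ k → (x ^ (n ∸ suc (toℕ k))) * (y ^ toℕ k)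

  -- For even n, the polynomial P_n(X,Y)/(X+Y) ∈ ℤ[X,Y], which equals
  -- (X^n - Y^n)/(X^2 - Y^2) = P_{n/2}(X^2, Y^2), evaluated at (x,y).
  PdivSum : ℕ → A → A → A
  PdivSum n x y = P (n / 2) (x ^ 2) (y ^ 2)

module _ (D : CommutativeRing c ℓ) (E : CommutativeRing c₂ ℓ₂) where
  private
    module D = CommutativeRing D
    module E = CommutativeRing E
  open RawSemiringDefs (Semiring.rawSemiring E.semiring) using (sum; _^_)

  IsAlgebraicOver : (D.Carrier → E.Carrier) → E.Carrier → Set (c ⊔ ℓ ⊔ ℓ₂)
  IsAlgebraicOver ι x =
    Σ ℕ λ d → Σ (Fin (suc d) → D.Carrier) λ cs →
      (Σ (Fin (suc d)) λ i → ¬ (cs i D.≈ D.0#)) ×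
      (sum {suc d} (λ i → ι (cs i) E.* (x ^ toℕ i)) E.≈ E.0#)

-- In D consider the sequence L₀ = 0, L₁ = 1, L_{k+2} = c_k L_{k+1} − q L_k, where c_k = 1 for
-- even k and c_k = r for odd k. Since ι r = (a+b)² and ι q = ab, the identities
-- P_{2j+2}/(a+b) = P_{2j+1} − ab P_{2j}/(a+b) and P_{2j+3} = (a+b)² P_{2j+2}/(a+b) − ab P_{2j+1}
-- give ι L_{2j} = P_{2j}(a,b)/(a+b) and ι L_{2j+1} = P_{2j+1}(a,b).
-- Every term is a linear combination of any two consecutive terms, so a common divisor of L_j
-- and L_k divides L_{j+k}; by Bézout a prime dividing L_m and L_n then divides two consecutive
-- terms. Walking down the recurrence, such a prime either divides q and r, or divides L₁ = 1.
module Submission where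

open import Defs
open import Level using (Level)
open import Algebra.Bundles using (CommutativeRing)
open import Algebra.Bundles using (Semiring)
open import Algebra.Morphism.Structures using (module RingMorphisms)
open import Data.Nat using (ℕ; _≥_; _%_)
open import Data.Nat.Coprimality using (Coprime)
open import Data.Product using (Σ; _×_)
open import Relation.Binary.PropositionalEquality using (_≡_)

import Algebra.Definitions.RawSemiring as RawSemiringDefinitions
import Algebra.Properties.CommutativeSemigroup as CommutativeSemigroupProperties
import Algebra.Properties.CommutativeSemigroup.Divisibility as CommutativeSemigroupDivisibility
import Algebra.Properties.Group as GroupProperties
import Algebra.Properties.Ring as RingProperties
import Algebra.Properties.Semiring.Divisibility as SemiringDivisibility
import Algebra.Properties.Semiring.Exp as SemiringExp
import Algebra.Properties.Semiring.Sum as SemiringSum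
import Algebra.Solver.Ring.NaturalCoefficients.Default as SemiringSolver
open import Data.Bool.Base using (Bool; true; false; not)
open import Data.Bool.Properties using (not-involutive)
open import Data.Fin.Base using (toℕ)
open import Data.Nat as ℕ using (zero; suc; _/_)
open import Data.Nat.Coprimality using (coprime-Bézout)
open import Data.Nat.DivMod using (m≡m%n+[m/n]*n)
open import Data.Nat.GCD using (module Bézout)
open import Data.Nat.GeneralisedArithmetic using (fold; fold-+)
import Data.Nat.Properties as ℕₚ
open import Data.Product using (_,_; proj₁; proj₂)
open import Data.Sum using ([_,_]′)
open import Data.Empty using (⊥)
open import Function.Base using (_∘_)
open import Relation.Nullary using (¬_; contradiction)
import Relation.Binary.PropositionalEquality as ≡

module RingDivisibility {c ℓ} (R : CommutativeRing c ℓ) where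
  open CommutativeRing R
  open RawSemiringDefinitions (Semiring.rawSemiring semiring) using (_∣_)
  open import Algebra.Definitions.RawMagma using (_,_)
  open CommutativeSemigroupDivisibility *-commutativeSemigroup using (∣ʳ-respʳ-≈)
  open RingProperties ring using (-‿distribˡ-*; -‿involutive)
  open GroupProperties +-group using (//-rightDividesʳ; \\-leftDividesʳ)

  x∣y∧x∣z⇒x∣y+z : ∀ {x y z} → x ∣ y → x ∣ z → x ∣ y + z
  x∣y∧x∣z⇒x∣y+z {x} (u , ux≈y) (v , vx≈z) = u + v , trans (distribʳ x u v) (+-cong ux≈y vx≈z)

  x∣y⇒x∣-y : ∀ {x y} → x ∣ y → x ∣ - y
  x∣y⇒x∣-y {x} (u , ux≈y) = - u , trans (sym (-‿distribˡ-* u x)) (-‿cong ux≈y)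

  x∣-y⇒x∣y : ∀ {x y} → x ∣ - y → x ∣ y
  x∣-y⇒x∣y {y = y} x∣-y = ∣ʳ-respʳ-≈ (-‿involutive y) (x∣y⇒x∣-y x∣-y)

  x∣y+z∧x∣z⇒x∣y : ∀ {x y z} → x ∣ y + z → x ∣ z → x ∣ y
  x∣y+z∧x∣z⇒x∣y {y = y} {z} x∣y+z x∣z =
    ∣ʳ-respʳ-≈ (//-rightDividesʳ z y) (x∣y∧x∣z⇒x∣y+z x∣y+z (x∣y⇒x∣-y x∣z))

  x∣y+z∧x∣y⇒x∣z : ∀ {x y z} → x ∣ y + z → x ∣ y → x ∣ z
  x∣y+z∧x∣y⇒x∣z {y = y} {z} x∣y+z x∣y =
    ∣ʳ-respʳ-≈ (\\-leftDividesʳ y z) (x∣y∧x∣z⇒x∣y+z (x∣y⇒x∣-y x∣y) x∣y+z)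

module Lehmer {c ℓ} (R : CommutativeRing c ℓ) (r q : CommutativeRing.Carrier R) where
  open CommutativeRing R renaming (Carrier to A)
  open RawSemiringDefinitions (Semiring.rawSemiring semiring) using (_∣_; Prime)
  open CommutativeSemigroupDivisibility *-commutativeSemigroup
    using (∣ʳ-respʳ-≈; ∣ʳ-trans; x∣ʳy⇒x∣ʳzy; x∣xy)
  open SemiringDivisibility semiring using (_∣0)
  open RingDivisibility R
  open SemiringSolver commutativeSemiring using (solve; _:=_; _:+_; _:*_)
  open import Relation.Binary.Reasoning.Setoid setoid

  weight : Bool → A
  weight false = 1#
  weight true  = r

  record State : Set c where
    constructor ⟨_,_,_⟩
    field
      parity  : Bool
      current : A
      next    : A
  open State public

  -- -_ binds tighter than _*_: the new entry is w * y + (- q) * x, so that every identity below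
  -- is a semiring identity in the atom - q.
  step : State → State
  step ⟨ β , x , y ⟩ = ⟨ not β , y , weight β * y + - q * x ⟩

  run : ℕ → State → State
  run k s = fold s step k

  initial : State
  initial = ⟨ false , 0# , 1# ⟩

  lehmer : ℕ → A
  lehmer k = current (run k initial)

  parity-run : ∀ k s → parity (run k s) ≡ fold (parity s) not k
  parity-run zero    s = ≡.refl
  parity-run (suc k) s = ≡.cong not (parity-run k s)

  current-run-suc-suc : ∀ k s →
    current (run (suc (suc k)) s) ≡
    weight (fold (parity s) not k) * current (run (suc k) s) + - q * current (run k s)
  current-run-suc-suc k s =
    ≡.cong (λ β → weight β * current (run (suc k) s) + - q * current (run k s)) (parity-run k s)

  current-run-linear : ∀ k β x y →
    current (run k ⟨ β , x , y ⟩) ≈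
    y * current (run k ⟨ β , 0# , 1# ⟩) + x * current (run k ⟨ β , 1# , 0# ⟩)
  current-run-linear zero β x y =
    sym (trans (+-cong (zeroʳ y) (*-identityʳ x)) (+-identityˡ x))
  current-run-linear (suc zero) β x y =
    sym (trans (+-cong (*-identityʳ y) (zeroʳ x)) (+-identityʳ y))
  current-run-linear (suc (suc k)) β x y = begin
    current (run (2 ℕ.+ k) s)
      ≡⟨ current-run-suc-suc k s ⟩
    w * S₁ + - q * S₀
      ≈⟨ +-cong (*-congˡ (current-run-linear (suc k) β x y))
                (*-congˡ (current-run-linear k β x y)) ⟩
    w * (y * F₁ + x * K₁) + - q * (y * F₀ + x * K₀)
      ≈⟨ solve 8 (λ w q x y F₀ F₁ K₀ K₁ →
                    w :* (y :* F₁ :+ x :* K₁) :+ q :* (y :* F₀ :+ x :* K₀)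
                 := y :* (w :* F₁ :+ q :* F₀) :+ x :* (w :* K₁ :+ q :* K₀))
                refl w (- q) x y F₀ F₁ K₀ K₁ ⟩
    y * (w * F₁ + - q * F₀) + x * (w * K₁ + - q * K₀)
      ≡⟨ ≡.cong₂ (λ u v → y * u + x * v)
           (current-run-suc-suc k ⟨ β , 0# , 1# ⟩) (current-run-suc-suc k ⟨ β , 1# , 0# ⟩) ⟨
    y * current (run (2 ℕ.+ k) ⟨ β , 0# , 1# ⟩) + x * current (run (2 ℕ.+ k) ⟨ β , 1# , 0# ⟩) ∎
    where
    s = ⟨ β , x , y ⟩
    w = weight (fold β not k)
    S₀ = current (run k s)
    S₁ = current (run (suc k) s)
    F₀ = current (run k ⟨ β , 0# , 1# ⟩)
    F₁ = current (run (suc k) ⟨ β , 0# , 1# ⟩)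
    K₀ = current (run k ⟨ β , 1# , 0# ⟩)
    K₁ = current (run (suc k) ⟨ β , 1# , 0# ⟩)

  -- Starting the recurrence with the coefficients in the other order only rescales every
  -- term by 1 or r.
  Twisted : State → State → Set ℓ
  Twisted ⟨ β , x , y ⟩ t =
    (parity t ≡ not β) × (current t ≈ weight (not β) * x) × (next t ≈ weight β * y)

  step-Twisted : ∀ {s t} → Twisted s t → Twisted (step s) (step t)
  step-Twisted {⟨ β , x , y ⟩} {⟨ .(not β) , u , v ⟩} (≡.refl , u≈ , v≈) = ≡.refl , v≈′ , next≈
    where
    v≈′ : v ≈ weight (not (not β)) * y
    v≈′ rewrite not-involutive β = v≈
    next≈ : weight (not β) * v + - q * u ≈ weight (not β) * (weight β * y + - q * x)
    next≈ = begin
      weight (not β) * v + - q * u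
        ≈⟨ +-cong (*-congˡ v≈) (*-congˡ u≈) ⟩
      weight (not β) * (weight β * y) + - q * (weight (not β) * x)
        ≈⟨ solve 5 (λ w′ w q x y → w′ :* (w :* y) :+ q :* (w′ :* x) := w′ :* (w :* y :+ q :* x))
             refl (weight (not β)) (weight β) (- q) x y ⟩
      weight (not β) * (weight β * y + - q * x) ∎

  run-Twisted : ∀ k {s t} → Twisted s t → Twisted (run k s) (run k t)
  run-Twisted zero    s~t = s~t
  run-Twisted (suc k) s~t = step-Twisted (run-Twisted k s~t)

  initial-Twisted : Twisted initial ⟨ true , 0# , 1# ⟩
  initial-Twisted = ≡.refl , sym (zeroʳ r) , sym (*-identityˡ 1#)

  ∣lehmer⇒∣current-run : ∀ {d} β k → d ∣ lehmer k → d ∣ current (run k ⟨ β , 0# , 1# ⟩)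
  ∣lehmer⇒∣current-run false k d∣Lₖ = d∣Lₖ
  ∣lehmer⇒∣current-run true  k d∣Lₖ =
    ∣ʳ-respʳ-≈ (sym (proj₁ (proj₂ (run-Twisted k initial-Twisted)))) (x∣ʳy⇒x∣ʳzy _ d∣Lₖ)

  ∣-lehmer-+ : ∀ {d} j k → d ∣ lehmer j → d ∣ lehmer k → d ∣ lehmer (j ℕ.+ k)
  ∣-lehmer-+ {d} j k d∣Lⱼ d∣Lₖ =
    ≡.subst (d ∣_) (≡.cong current (≡.sym (fold-+ initial step j)))
      (∣ʳ-respʳ-≈ (sym (current-run-linear j (parity s) (lehmer k) (lehmer (suc k))))
        (x∣y∧x∣z⇒x∣y+z (x∣ʳy⇒x∣ʳzy (lehmer (suc k)) (∣lehmer⇒∣current-run (parity s) j d∣Lⱼ))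
                       (∣ʳ-trans d∣Lₖ (x∣xy (lehmer k) _))))
    where s = run k initial

  ∣-lehmer-* : ∀ {d} k m → d ∣ lehmer m → d ∣ lehmer (k ℕ.* m)
  ∣-lehmer-* {d} zero    m _     = d ∣0
  ∣-lehmer-* (suc k) m d∣Lₘ = ∣-lehmer-+ m (k ℕ.* m) d∣Lₘ (∣-lehmer-* k m d∣Lₘ)

  module _ {p} (p-prime : Prime p) where
    open Prime p-prime

    ∣weight⇒∣r : ∀ β → p ∣ weight β → p ∣ r
    ∣weight⇒∣r false p∣1 = contradiction p∣1 p∤1
    ∣weight⇒∣r true  p∣r = p∣r

    ∣q∧∣lehmer-suc⇒∣r : p ∣ q → ∀ l → p ∣ lehmer (suc l) → p ∣ r
    ∣q∧∣lehmer-suc⇒∣r p∣q zero    p∣1 = contradiction p∣1 p∤1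
    ∣q∧∣lehmer-suc⇒∣r p∣q (suc l) p∣Lₗ₊₂ =
      [ ∣weight⇒∣r (parity (run l initial)) , ∣q∧∣lehmer-suc⇒∣r p∣q l ]′
        (split-∣ (x∣y+z∧x∣z⇒x∣y p∣Lₗ₊₂ (∣ʳ-trans (x∣y⇒x∣-y p∣q) (x∣xy (- q) (lehmer l)))))

    ∤q∧∣lehmer∧∣lehmer-suc⇒⊥ : ¬ p ∣ q → ∀ l → p ∣ lehmer l → p ∣ lehmer (suc l) → ⊥
    ∤q∧∣lehmer∧∣lehmer-suc⇒⊥ p∤q zero    _     p∣1 = p∤1 p∣1
    ∤q∧∣lehmer∧∣lehmer-suc⇒⊥ p∤q (suc l) p∣Lₗ₊₁ p∣Lₗ₊₂ =
      [ p∤q ∘ x∣-y⇒x∣y , (λ p∣Lₗ → ∤q∧∣lehmer∧∣lehmer-suc⇒⊥ p∤q l p∣Lₗ p∣Lₗ₊₁) ]′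
        (split-∣ (x∣y+z∧x∣y⇒x∣z p∣Lₗ₊₂ (x∣ʳy⇒x∣ʳzy _ p∣Lₗ₊₁)))

  lehmer-consecutive-coprime : CoprimeElts R r q → ∀ l → CoprimeElts R (lehmer l) (lehmer (suc l))
  lehmer-consecutive-coprime r⊥q l p p-prime p∣Lₗ p∣Lₗ₊₁ =
    ∤q∧∣lehmer∧∣lehmer-suc⇒⊥ p-prime p∤q l p∣Lₗ p∣Lₗ₊₁
    where
    p∤q : ¬ p ∣ q
    p∤q p∣q = r⊥q p p-prime (∣q∧∣lehmer-suc⇒∣r p-prime p∣q l p∣Lₗ₊₁) p∣q

  lehmer-coprime : CoprimeElts R r q → ∀ {m n} → Coprime m n → CoprimeElts R (lehmer m) (lehmer n)
  lehmer-coprime r⊥q {m} {n} m⊥n p p-prime p∣Lₘ p∣Lₙ with coprime-Bézout m⊥n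
  ... | Bézout.+- x y 1+yn≡xm =
    lehmer-consecutive-coprime r⊥q (y ℕ.* n) p p-prime (∣-lehmer-* y n p∣Lₙ)
      (≡.subst (λ k → p ∣ lehmer k) (≡.sym 1+yn≡xm) (∣-lehmer-* x m p∣Lₘ))
  ... | Bézout.-+ x y 1+xm≡yn =
    lehmer-consecutive-coprime r⊥q (x ℕ.* m) p p-prime (∣-lehmer-* x m p∣Lₘ)
      (≡.subst (λ k → p ∣ lehmer k) (≡.sym 1+xm≡yn) (∣-lehmer-* y n p∣Lₙ))

module PIdentities {c ℓ} (R : CommutativeRing c ℓ) where
  open CommutativeRing R
  open RawSemiringDefinitions (Semiring.rawSemiring semiring) using (sum; _^_)
  open SemiringSum semiring using (sum-cong-≋; *-distribˡ-sum)
  open SemiringExp semiring using (^-assocʳ; ^-congʳ)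
  open CommutativeSemigroupProperties *-commutativeSemigroup using (x∙yz≈y∙xz)
  open RingProperties ring using (-‿distribˡ-*)
  open GroupProperties +-group using (//-rightDividesʳ)
  open SemiringSolver commutativeSemiring using (solve; _:=_; _:+_; _:*_)
  open import Relation.Binary.Reasoning.Setoid setoid

  x+yz≈u⇒u+[-y]z≈x : ∀ {x y z u} → x + y * z ≈ u → u + - y * z ≈ x
  x+yz≈u⇒u+[-y]z≈x {x} {y} {z} x+yz≈u =
    trans (+-cong (sym x+yz≈u) (sym (-‿distribˡ-* y z))) (//-rightDividesʳ (y * z) x)

  P-suc : ∀ k x y → P R (suc k) x y ≈ x ^ k + y * P R k x y
  P-suc k x y = +-cong (*-identityʳ (x ^ k)) (begin
    sum {k} (λ i → x ^ (k ℕ.∸ suc (toℕ i)) * (y * y ^ toℕ i))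
      ≈⟨ sum-cong-≋ {k} (λ i → x∙yz≈y∙xz (x ^ (k ℕ.∸ suc (toℕ i))) y (y ^ toℕ i)) ⟩
    sum {k} (λ i → y * (x ^ (k ℕ.∸ suc (toℕ i)) * y ^ toℕ i))
      ≈⟨ *-distribˡ-sum {k} y (λ i → x ^ (k ℕ.∸ suc (toℕ i)) * y ^ toℕ i) ⟨
    y * P R k x y ∎)

  P-suc-suc : ∀ k x y → P R (suc (suc k)) x y + x * y * P R k x y ≈ (x + y) * P R (suc k) x y
  P-suc-suc k x y = begin
    P R (2 ℕ.+ k) x y + x * y * P R k x y
      ≈⟨ +-congʳ (trans (P-suc (suc k) x y) (+-congˡ (*-congˡ (P-suc k x y)))) ⟩
    x * x ^ k + y * (x ^ k + y * P R k x y) + x * y * P R k x y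
      ≈⟨ solve 4 (λ x y X P → x :* X :+ y :* (X :+ y :* P) :+ x :* y :* P
                          := (x :+ y) :* (X :+ y :* P))
           refl x y (x ^ k) (P R k x y) ⟩
    (x + y) * (x ^ k + y * P R k x y)
      ≈⟨ *-congˡ (P-suc k x y) ⟨
    (x + y) * P R (suc k) x y ∎

  P-squares-suc : ∀ j x y →
    P R (suc j) (x ^ 2) (y ^ 2) ≈ x ^ (j ℕ.* 2) + y * y * P R j (x ^ 2) (y ^ 2)
  P-squares-suc j x y = trans (P-suc j (x ^ 2) (y ^ 2))
    (+-cong (trans (^-assocʳ x 2 j) (^-congʳ x (ℕₚ.*-comm 2 j)))
            (*-congʳ (*-congˡ (*-identityʳ y))))

  P-even : ∀ j x y → P R (j ℕ.* 2) x y ≈ (x + y) * P R j (x ^ 2) (y ^ 2)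
  P-even zero    x y = sym (zeroʳ (x + y))
  P-even (suc j) x y = begin
    P R (2 ℕ.+ j ℕ.* 2) x y
      ≈⟨ trans (P-suc (suc (j ℕ.* 2)) x y) (+-congˡ (*-congˡ (P-suc (j ℕ.* 2) x y))) ⟩
    x * X + y * (X + y * P R (j ℕ.* 2) x y)
      ≈⟨ +-congˡ (*-congˡ (+-congˡ (*-congˡ (P-even j x y)))) ⟩
    x * X + y * (X + y * ((x + y) * T))
      ≈⟨ solve 4 (λ x y X T → x :* X :+ y :* (X :+ y :* ((x :+ y) :* T))
                          := (x :+ y) :* (X :+ y :* y :* T))
           refl x y X T ⟩
    (x + y) * (X + y * y * T)
      ≈⟨ *-congˡ (P-squares-suc j x y) ⟨
    (x + y) * P R (suc j) (x ^ 2) (y ^ 2) ∎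
    where
    X = x ^ (j ℕ.* 2)
    T = P R j (x ^ 2) (y ^ 2)

  P-odd : ∀ j x y →
    P R (suc j) (x ^ 2) (y ^ 2) + x * y * P R j (x ^ 2) (y ^ 2) ≈ P R (suc (j ℕ.* 2)) x y
  P-odd j x y = begin
    P R (suc j) (x ^ 2) (y ^ 2) + x * y * T
      ≈⟨ +-congʳ (P-squares-suc j x y) ⟩
    X + y * y * T + x * y * T
      ≈⟨ solve 4 (λ x y X T → X :+ y :* y :* T :+ x :* y :* T := X :+ y :* ((x :+ y) :* T))
           refl x y X T ⟩
    X + y * ((x + y) * T)
      ≈⟨ +-congˡ (*-congˡ (P-even j x y)) ⟨
    X + y * P R (j ℕ.* 2) x y
      ≈⟨ P-suc (j ℕ.* 2) x y ⟨
    P R (suc (j ℕ.* 2)) x y ∎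
    where
    X = x ^ (j ℕ.* 2)
    T = P R j (x ^ 2) (y ^ 2)

module LehmerImage {c ℓ c₂ ℓ₂} (D : CommutativeRing c ℓ) (E : CommutativeRing c₂ ℓ₂) where
  private
    module D = CommutativeRing D
    module E = CommutativeRing E

  module _ {ι : D.Carrier → E.Carrier} (ι-homo : RingMorphisms.IsRingHomomorphism D.rawRing E.rawRing ι)
           {a b : E.Carrier} {r q : D.Carrier}
           (ι-r : ι r E.≈ (a E.+ b) E.* (a E.+ b)) (ι-q : ι q E.≈ a E.* b) where
    open CommutativeRing E
    open RawSemiringDefinitions (Semiring.rawSemiring semiring) using (_^_)
    open RingMorphisms.IsRingHomomorphism ι-homo
    open Lehmer D r q
    open PIdentities E
    open import Relation.Binary.Reasoning.Setoid setoid

    parity-run-even : ∀ j → parity (run (j ℕ.* 2) initial) ≡ false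
    parity-run-even zero    = ≡.refl
    parity-run-even (suc j) = ≡.cong (not ∘ not) (parity-run-even j)

    ι-lehmer-suc-suc : ∀ k →
      ι (lehmer (suc (suc k))) ≈
      ι (weight (parity (run k initial))) * ι (lehmer (suc k)) + - (a * b) * ι (lehmer k)
    ι-lehmer-suc-suc k = trans (+-homo _ _)
      (+-cong (*-homo _ _) (trans (*-homo _ _) (*-congʳ (trans (-‿homo q) (-‿cong ι-q)))))

    ι-lehmer : ∀ j →
      (ι (lehmer (j ℕ.* 2)) ≈ P E j (a ^ 2) (b ^ 2)) ×
      (ι (lehmer (suc (j ℕ.* 2))) ≈ P E (suc (j ℕ.* 2)) a b)
    ι-lehmer zero    = 0#-homo , trans 1#-homo (sym (trans (+-identityʳ _) (*-identityˡ 1#)))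
    ι-lehmer (suc j) = ι-lehmer-even , ι-lehmer-odd
      where
      i = j ℕ.* 2
      π = parity (run i initial)
      T₀ = P E j (a ^ 2) (b ^ 2)
      T₁ = P E (suc j) (a ^ 2) (b ^ 2)
      U₁ = P E (suc i) a b

      ι-weight-even : ι (weight π) ≈ 1#
      ι-weight-even rewrite parity-run-even j = 1#-homo

      ι-weight-odd : ι (weight (not π)) ≈ (a + b) * (a + b)
      ι-weight-odd rewrite parity-run-even j = ι-r

      ι-lehmer-even : ι (lehmer (2 ℕ.+ i)) ≈ T₁
      ι-lehmer-even = begin
        ι (lehmer (2 ℕ.+ i))
          ≈⟨ ι-lehmer-suc-suc i ⟩
        ι (weight π) * ι (lehmer (suc i)) + - (a * b) * ι (lehmer i)
          ≈⟨ +-cong (*-cong ι-weight-even (proj₂ (ι-lehmer j))) (*-congˡ (proj₁ (ι-lehmer j))) ⟩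
        1# * U₁ + - (a * b) * T₀
          ≈⟨ +-congʳ (*-identityˡ U₁) ⟩
        U₁ + - (a * b) * T₀
          ≈⟨ x+yz≈u⇒u+[-y]z≈x (P-odd j a b) ⟩
        T₁ ∎

      ι-lehmer-odd : ι (lehmer (3 ℕ.+ i)) ≈ P E (3 ℕ.+ i) a b
      ι-lehmer-odd = begin
        ι (lehmer (3 ℕ.+ i))
          ≈⟨ ι-lehmer-suc-suc (suc i) ⟩
        ι (weight (not π)) * ι (lehmer (2 ℕ.+ i)) + - (a * b) * ι (lehmer (suc i))
          ≈⟨ +-cong (*-cong ι-weight-odd ι-lehmer-even) (*-congˡ (proj₂ (ι-lehmer j))) ⟩
        (a + b) * (a + b) * T₁ + - (a * b) * U₁
          ≈⟨ +-congʳ (trans (*-assoc (a + b) (a + b) T₁) (*-congˡ (sym (P-even (suc j) a b)))) ⟩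
        (a + b) * P E (2 ℕ.+ i) a b + - (a * b) * U₁
          ≈⟨ x+yz≈u⇒u+[-y]z≈x (P-suc-suc (suc i) a b) ⟩
        P E (3 ℕ.+ i) a b ∎

    ι-lehmer-odd : ∀ m → m % 2 ≡ 1 → ι (lehmer m) ≈ P E m a b
    ι-lehmer-odd m m%2≡1 =
      ≡.subst (λ k → ι (lehmer k) ≈ P E k a b) (≡.sym m≡1+[m/2]*2) (proj₂ (ι-lehmer (m / 2)))
      where
      m≡1+[m/2]*2 : m ≡ suc (m / 2 ℕ.* 2)
      m≡1+[m/2]*2 = ≡.trans (m≡m%n+[m/n]*n m 2) (≡.cong (ℕ._+ m / 2 ℕ.* 2) m%2≡1)

    ι-lehmer-even : ∀ n → n % 2 ≡ 0 → ι (lehmer n) ≈ PdivSum E n a b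
    ι-lehmer-even n n%2≡0 =
      ≡.subst (λ k → ι (lehmer k) ≈ PdivSum E n a b) (≡.sym n≡[n/2]*2) (proj₁ (ι-lehmer (n / 2)))
      where
      n≡[n/2]*2 : n ≡ n / 2 ℕ.* 2
      n≡[n/2]*2 = ≡.trans (m≡m%n+[m/n]*n n 2) (≡.cong (ℕ._+ n / 2 ℕ.* 2) n%2≡0)

lemma2p6 : ∀ {c ℓ c₂ ℓ₂ : Level} (D : CommutativeRing c ℓ) (E : CommutativeRing c₂ ℓ₂) →
    IsUFD D → IsIntegralDomain E →
    (ι : CommutativeRing.Carrier D → CommutativeRing.Carrier E) →
    RingMorphisms.IsRingMonomorphism (CommutativeRing.rawRing D) (CommutativeRing.rawRing E) ι →
    (a b : CommutativeRing.Carrier E) →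
    IsAlgebraicOver D E ι a → IsAlgebraicOver D E ι b →
    (r q : CommutativeRing.Carrier D) →
    CommutativeRing._≈_ E (ι r) (CommutativeRing._*_ E (CommutativeRing._+_ E a b) (CommutativeRing._+_ E a b)) →
    CommutativeRing._≈_ E (ι q) (CommutativeRing._*_ E a b) →
    CoprimeElts D r q →
    (m n : ℕ) → m ≥ 1 → n ≥ 1 → Coprime m n → m % 2 ≡ 1 → n % 2 ≡ 0 →
    Σ (CommutativeRing.Carrier D) λ u → Σ (CommutativeRing.Carrier D) λ v →
      CommutativeRing._≈_ E (ι u) (P E m a b) ×
      CommutativeRing._≈_ E (ι v) (PdivSum E n a b) ×
      CoprimeElts D u v
lemma2p6 D E _ _ ι ι-mono a b _ _ r q ι-r ι-q r⊥q m n _ _ m⊥n m%2≡1 n%2≡0 =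
  lehmer m , lehmer n ,
  ι-lehmer-odd ι-homo ι-r ι-q m m%2≡1 , ι-lehmer-even ι-homo ι-r ι-q n n%2≡0 ,
  lehmer-coprime r⊥q m⊥n
  where
  open Lehmer D r q using (lehmer; lehmer-coprime)
  open LehmerImage D E using (ι-lehmer-odd; ι-lehmer-even)
  open RingMorphisms.IsRingMonomorphism ι-mono using () renaming (isRingHomomorphism to ι-homo)
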